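{- Let $G=(V,E^+,E^-)$ be a signed network, let $(C_L,C_R)$ be a balanced clique of $G$, and let $P_L,P_R\subseteq V$ be sets disjoint from $C_L\cup C_R$. Let $\mathbb{G}_L$ (resp. $\mathbb{G}_R$) denote the subgraph of $G^+=(V,E^+)$ induced by $P_L$ (resp. $P_R$), and let $\gamma(\cdot)$ denote chromatic number. Let $C'=(C'_L,C'_R)$ be a balanced clique of $G$ of maximum size $|C'_L|+|C'_R|$ among the balanced cliques satisfying $C_L\subseteq C'_L\subseteq C_L\cup P_L$ and $C_R\subseteq C'_R\subseteq C_R\cup P_R$. Then $|C'_L|\le \gamma(\mathbb{G}_L)+|C_L|$ and $|C'_R|\le\gamma(\mathbb{G}_R)+|C_R|$.
   Context: A signed network $G=(V,E^+,E^-)$ is a simple undirected graph whose edge set is partitioned into positive edges $E^+$ and negative edges $E^-$. A balanced clique of $G$ is a vertex set $C$ with a partition $C=C_L\cup C_R$ such that every two distinct vertices of $C$ are adjacent, every edge with both endpoints in $C_L$ or both in $C_R$ is positive, and every edge between $C_L$ and $C_R$ is negative. The chromatic number $\gamma(H)$ of an unsigned graph $H$ is the minimum number of colors in a proper vertex coloring of $H$ (adjacent vertices receive different colors); $\gamma$ of the empty graph is $0$. -}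

module Defs where

open import Data.Nat using (ℕ; _+_; _≤_)
open import Data.Bool using (Bool; true; false)
open import Data.Fin using (Fin)
open import Data.Fin.Subset using (Subset; _∈_; _∉_; _⊆_; _∪_; ∣_∣)
open import Data.Empty using (⊥)
open import Data.Product using (_×_; Σ)
open import Relation.Binary.PropositionalEquality using (_≡_; _≢_)

record SignedNetwork (n : ℕ) : Set where
  field
    pos : Fin n → Fin n → Bool
    neg : Fin n → Fin n → Bool
    pos-sym  : ∀ u v → pos u v ≡ pos v u
    neg-sym  : ∀ u v → neg u v ≡ neg v u
    pos-irr  : ∀ v → pos v v ≡ false
    neg-irr  : ∀ v → neg v v ≡ false
    pos-neg-disj : ∀ u v → pos u v ≡ true → neg u v ≡ false

open SignedNetwork public

Disjoint : ∀ {n} → Subset n → Subset n → Set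
Disjoint A B = ∀ v → v ∈ A → v ∈ B → ⊥

IsBalancedClique : ∀ {n} → SignedNetwork n → Subset n → Subset n → Set
IsBalancedClique G CL CR =
  Disjoint CL CR
  × (∀ u v → u ∈ CL → v ∈ CL → u ≢ v → pos G u v ≡ true)
  × (∀ u v → u ∈ CR → v ∈ CR → u ≢ v → pos G u v ≡ true)
  × (∀ u v → u ∈ CL → v ∈ CR → neg G u v ≡ true)

ProperColouring : ∀ {n} → SignedNetwork n → Subset n → ℕ → Set
ProperColouring {n} G P k =
  Σ ((v : Fin n) → v ∈ P → Fin k) λ c →
    ∀ u v (u∈P : u ∈ P) (v∈P : v ∈ P) → pos G u v ≡ true → c u u∈P ≢ c v v∈P

IsChromaticNumber : ∀ {n} → SignedNetwork n → Subset n → ℕ → Set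
IsChromaticNumber G P k =
  ProperColouring G P k × (∀ j → ProperColouring G P j → k ≤ j)

IsExtension : ∀ {n} → SignedNetwork n → (CL CR PL PR C'L C'R : Subset n) → Set
IsExtension G CL CR PL PR C'L C'R =
  IsBalancedClique G C'L C'R
  × CL ⊆ C'L × C'L ⊆ (CL ∪ PL)
  × CR ⊆ C'R × C'R ⊆ (CR ∪ PR)

IsMaximumExtension : ∀ {n} → SignedNetwork n → (CL CR PL PR C'L C'R : Subset n) → Set
IsMaximumExtension G CL CR PL PR C'L C'R =
  IsExtension G CL CR PL PR C'L C'R
  × (∀ DL DR → IsExtension G CL CR PL PR DL DR → ∣ DL ∣ + ∣ DR ∣ ≤ ∣ C'L ∣ + ∣ C'R ∣)

{-# OPTIONS --safe #-}
-- Only the inclusions C'L ⊆ CL ∪ PL and C'R ⊆ CR ∪ PR and the positivity of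
-- the edges inside each side matter.  The vertices of C'L outside CL form a
-- clique of G⁺ lying in PL, so a proper colouring of G⁺[PL] gives them pairwise
-- distinct colours: there are at most γL of them.
module Submission where

open import Defs
open import Data.Nat using (ℕ; zero; suc; _+_; _≤_; z≤n; s≤s)
open import Data.Nat.Properties using (≤-trans; +-monoˡ-≤; +-monoʳ-≤; +-suc)
open import Data.Fin using (Fin; punchOut) renaming (zero to fzero; suc to fsuc)
open import Data.Fin.Properties using (punchOut-injective; suc-injective)
open import Data.Fin.Subset using (Subset; inside; outside; _∈_; _∉_; _⊆_; _∪_; _─_; ∣_∣)
open import Data.Fin.Subset.Properties
  using (∣p∣≤∣x∷p∣; p─q⊆p; x∈p∪q⁻; drop-there)
open import Data.Vec.Base using ([]; _∷_; here; there)
open import Data.Bool using (true)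
open import Data.Sum using (inj₁; inj₂)
open import Data.Product using (_×_; _,_)
open import Relation.Nullary using (contradiction)
open import Relation.Binary.PropositionalEquality using (_≡_; _≢_; sym; subst)
open import Function using (_∘_)

private
  variable
    n k : ℕ

InjectiveOn : (p : Subset n) → ((v : Fin n) → v ∈ p → Fin k) → Set
InjectiveOn p f = ∀ {u v} (u∈p : u ∈ p) (v∈p : v ∈ p) → u ≢ v → f u u∈p ≢ f v v∈p

injectiveOn⇒∣p∣≤ : (p : Subset n) (f : (v : Fin n) → v ∈ p → Fin k) →
                   InjectiveOn p f → ∣ p ∣ ≤ k
injectiveOn⇒∣p∣≤ []            f inj = z≤n
injectiveOn⇒∣p∣≤ (outside ∷ p) f inj =
  injectiveOn⇒∣p∣≤ p (λ v → f (fsuc v) ∘ there)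
    (λ u∈p v∈p u≢v → inj (there u∈p) (there v∈p) (u≢v ∘ suc-injective))
injectiveOn⇒∣p∣≤ {k = zero}  (inside ∷ p) f inj with () ← f fzero here
injectiveOn⇒∣p∣≤ {k = suc k} (inside ∷ p) f inj =
  s≤s (injectiveOn⇒∣p∣≤ p f′ inj′)
  where
  -- f′ drops the colour of vertex 0 from the palette of the remaining vertices.
  f₀≢f : ∀ {v} (v∈p : v ∈ p) → f fzero here ≢ f (fsuc v) (there v∈p)
  f₀≢f v∈p = inj here (there v∈p) λ ()

  f′ : (v : Fin _) → v ∈ p → Fin k
  f′ v v∈p = punchOut (f₀≢f v∈p)

  inj′ : InjectiveOn p f′
  inj′ u∈p v∈p u≢v =
    inj (there u∈p) (there v∈p) (u≢v ∘ suc-injective)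
      ∘ punchOut-injective (f₀≢f u∈p) (f₀≢f v∈p)

∣p∣≤∣p─q∣+∣q∣ : (p q : Subset n) → ∣ p ∣ ≤ ∣ p ─ q ∣ + ∣ q ∣
∣p∣≤∣p─q∣+∣q∣ []            []            = z≤n
∣p∣≤∣p─q∣+∣q∣ (outside ∷ p) (outside ∷ q) = ∣p∣≤∣p─q∣+∣q∣ p q
∣p∣≤∣p─q∣+∣q∣ (outside ∷ p) (inside ∷ q)  =
  ≤-trans (∣p∣≤∣p─q∣+∣q∣ p q) (+-monoʳ-≤ ∣ p ─ q ∣ (∣p∣≤∣x∷p∣ inside q))
∣p∣≤∣p─q∣+∣q∣ (inside ∷ p)  (outside ∷ q) = s≤s (∣p∣≤∣p─q∣+∣q∣ p q)
∣p∣≤∣p─q∣+∣q∣ (inside ∷ p)  (inside ∷ q)  =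
  subst (suc ∣ p ∣ ≤_) (sym (+-suc ∣ p ─ q ∣ ∣ q ∣)) (s≤s (∣p∣≤∣p─q∣+∣q∣ p q))

x∈p─q⇒x∉q : ∀ {x : Fin n} {p q : Subset n} → x ∈ p ─ q → x ∉ q
x∈p─q⇒x∉q {p = inside ∷ p} {outside ∷ q} here          ()
x∈p─q⇒x∉q {p = _ ∷ p}      {outside ∷ q} (there x∈p─q) = x∈p─q⇒x∉q x∈p─q ∘ drop-there
x∈p─q⇒x∉q {p = _ ∷ p}      {inside ∷ q}  (there x∈p─q) = x∈p─q⇒x∉q x∈p─q ∘ drop-there

p⊆q∪r⇒p─q⊆r : ∀ {p q r : Subset n} → p ⊆ q ∪ r → p ─ q ⊆ r
p⊆q∪r⇒p─q⊆r {p = p} {q} {r} p⊆q∪r x∈p─q with x∈p∪q⁻ q r (p⊆q∪r (p─q⊆p p q x∈p─q))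
... | inj₁ x∈q = contradiction x∈q (x∈p─q⇒x∉q x∈p─q)
... | inj₂ x∈r = x∈r

IsPositiveClique : SignedNetwork n → Subset n → Set
IsPositiveClique G S = ∀ u v → u ∈ S → v ∈ S → u ≢ v → pos G u v ≡ true

positiveClique⊆P⇒∣S∣≤colours : (G : SignedNetwork n) {P S : Subset n} →
  ProperColouring G P k → IsPositiveClique G S → S ⊆ P → ∣ S ∣ ≤ k
positiveClique⊆P⇒∣S∣≤colours G {S = S} (c , proper) clique S⊆P =
  injectiveOn⇒∣p∣≤ S (λ v → c v ∘ S⊆P)
    λ {u} {v} u∈S v∈S u≢v → proper u v _ _ (clique u v u∈S v∈S u≢v)

positiveClique⊆T∪P⇒∣S∣≤colours+∣T∣ : (G : SignedNetwork n) {T P S : Subset n} →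
  ProperColouring G P k → IsPositiveClique G S → S ⊆ T ∪ P → ∣ S ∣ ≤ k + ∣ T ∣
positiveClique⊆T∪P⇒∣S∣≤colours+∣T∣ G {T} {S = S} colouring clique S⊆T∪P =
  ≤-trans (∣p∣≤∣p─q∣+∣q∣ S T)
    (+-monoˡ-≤ ∣ T ∣
      (positiveClique⊆P⇒∣S∣≤colours G colouring
        (λ u v u∈ v∈ → clique u v (p─q⊆p S T u∈) (p─q⊆p S T v∈))
        (p⊆q∪r⇒p─q⊆r S⊆T∪P)))

mainTheorem4 : ∀ {n} (G : SignedNetwork n) (CL CR PL PR C'L C'R : Subset n) (γL γR : ℕ)
    → IsBalancedClique G CL CR
    → Disjoint PL (CL ∪ CR)
    → Disjoint PR (CL ∪ CR)
    → IsChromaticNumber G PL γL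
    → IsChromaticNumber G PR γR
    → IsMaximumExtension G CL CR PL PR C'L C'R
    → (∣ C'L ∣ ≤ γL + ∣ CL ∣) × (∣ C'R ∣ ≤ γR + ∣ CR ∣)
mainTheorem4 G CL CR PL PR C'L C'R γL γR _ _ _ (colouringL , _) (colouringR , _)
  (((_ , cliqueL , cliqueR , _) , _ , C'L⊆CL∪PL , _ , C'R⊆CR∪PR) , _) =
    positiveClique⊆T∪P⇒∣S∣≤colours+∣T∣ G colouringL cliqueL C'L⊆CL∪PL
  , positiveClique⊆T∪P⇒∣S∣≤colours+∣T∣ G colouringR cliqueR C'R⊆CR∪PR
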